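{- Let $G_B$ be a boundaried graph, $T_G\subseteq V(G)$, and $\ell\ge0$ such that $(G,T_G)$ has a Deletable Terminal Multiway Cut solution $S$ with $|S|\le\ell$. Let $v\in B$ be such that there exist $\ell+|B|+2$ paths in $G$, each starting at $v$ and ending at a vertex of $T_G$, with pairwise distinct end vertices, and any two of which intersect only in $v$. Let $G'$ be obtained from $G$ by removing all edges incident with $v$, and adding two new vertices $t_{v,1},t_{v,2}$ (not in $B$) each adjacent only to $v$; let $T'_G:=T_G\cup\{t_{v,1},t_{v,2}\}$. Then for every boundaried graph $H_B$ with $V(H)\cap V(G)=V(H)\cap V(G')=B$ and every $T_H\subseteq V(H)$, $\mathrm{OPT}(G_B\oplus H_B,T_G\cup T_H)=\mathrm{OPT}(G'_B\oplus H_B,T'_G\cup T_H)$, where $\mathrm{OPT}$ is the optimum of Deletable Terminal Multiway Cut.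
   Context: All graphs are finite, simple, undirected. A boundaried graph $G_B$ is a graph $G$ with $B\subseteq V(G)$; for $V(G)\cap V(H)=B$, $G_B\oplus H_B$ has vertex set $V(G)\cup V(H)$ and edge set $E(G)\cup E(H)$ (so edges of $H$ incident with $v$ remain in $G'_B\oplus H_B$). Deletable Terminal Multiway Cut: given a graph $G$ and $T\subseteq V(G)$, a feasible solution is any $Y\subseteq V(G)$ such that $G-Y$ has no path between two distinct vertices of $T\setminus Y$; value $|Y|$; $\mathrm{OPT}$ is the minimum value. -}

module Defs where

open import Data.Nat using (ℕ; _+_; _≤_; _≡ᵇ_)
open import Data.Bool using (Bool; true; false; _∧_; _∨_; not)
open import Data.List using (List; []; _∷_; _++_; length)
open import Data.List.Membership.Propositional using (_∈_; _∉_)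
open import Data.List.Relation.Unary.Unique.Propositional using (Unique)
open import Data.Fin using (Fin)
open import Data.Product using (_×_; Σ; ∃)
open import Relation.Nullary using (¬_)
open import Relation.Binary.PropositionalEquality using (_≡_; _≢_)

-- Vertices are natural numbers (a universal vertex supply, so that
-- vertex sets of different graphs can share vertices, as in boundaried graphs).
record Graph : Set where
  constructor mkGraph
  field
    V   : List ℕ
    adj : ℕ → ℕ → Bool
open Graph public

record SimpleGraph (G : Graph) : Set where
  field
    symm    : ∀ x y → adj G x y ≡ adj G y x
    irrefl  : ∀ x → adj G x x ≡ false
    inV     : ∀ x y → adj G x y ≡ true → (x ∈ V G) × (y ∈ V G)

_⊆_ : List ℕ → List ℕ → Set
A ⊆ C = ∀ {x} → x ∈ A → x ∈ C

_⊕_ : Graph → Graph → Graph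
G ⊕ H = mkGraph (V G ++ V H) (λ x y → adj G x y ∨ adj H x y)

splitAt : Graph → ℕ → ℕ → ℕ → Graph
splitAt G v t1 t2 = mkGraph (V G ++ t1 ∷ t2 ∷ [])
  (λ x y → (adj G x y ∧ not (x ≡ᵇ v) ∧ not (y ≡ᵇ v))
         ∨ ((x ≡ᵇ v) ∧ ((y ≡ᵇ t1) ∨ (y ≡ᵇ t2)))
         ∨ ((y ≡ᵇ v) ∧ ((x ≡ᵇ t1) ∨ (x ≡ᵇ t2))))

data Connected (G : Graph) (Y : List ℕ) : ℕ → ℕ → Set where
  here : ∀ {s} → s ∈ V G → s ∉ Y → Connected G Y s s
  step : ∀ {s u t} → s ∈ V G → s ∉ Y → adj G s u ≡ true →
         Connected G Y u t → Connected G Y s t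

Feasible : Graph → List ℕ → List ℕ → Set
Feasible G T Y =
  Unique Y × (Y ⊆ V G) ×
  (∀ s t → s ∈ T → t ∈ T → s ∉ Y → t ∉ Y → s ≢ t → ¬ Connected G Y s t)

IsOPT : Graph → List ℕ → ℕ → Set
IsOPT G T k =
  (Σ (List ℕ) λ Y → Feasible G T Y × length Y ≡ k) ×
  (∀ Y → Feasible G T Y → k ≤ length Y)

data Walk (G : Graph) : List ℕ → ℕ → ℕ → Set where
  single : ∀ {x} → x ∈ V G → Walk G (x ∷ []) x x
  cons   : ∀ {x y p z} → x ∈ V G → adj G x y ≡ true →
           Walk G (y ∷ p) y z → Walk G (x ∷ y ∷ p) x z

IsPath : Graph → List ℕ → ℕ → ℕ → Set
IsPath G P a b = Walk G P a b × Unique P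

FanFrom : Graph → List ℕ → ℕ → ℕ → Set
FanFrom G T v n =
  Σ (Fin n → List ℕ) λ P → Σ (Fin n → ℕ) λ e →
    (∀ i → IsPath G (P i) v (e i)) ×
    (∀ i → e i ∈ T) ×
    (∀ i j → i ≢ j → e i ≢ e j) ×
    (∀ i j → i ≢ j → ∀ x → x ∈ P i → x ∈ P j → x ≡ v)

-- Two instances have the same optimum as soon as every feasible solution of either one can be
-- turned into a feasible solution of the other that is no larger.
--
-- In G ⊕ H with v deleted, the split graph G′ ⊕ H has the same separation problem: away from v
-- nothing changes, and the new terminals t₁, t₂ hang off the deleted v.  Conversely a solution
-- of G′ ⊕ H must meet {v, t₁, t₂} (else t₁ – v – t₂ connects two terminals), and replacing those
-- vertices by v alone gives a solution for G ⊕ H.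
--
-- It remains to see that a solution X of G ⊕ H avoiding v can be traded for one containing v.
-- Of the ℓ + |B| + 2 fan paths at most one avoids X (two avoiding paths join two terminals
-- through v), and the others meet X in pairwise distinct vertices of G, so |X ∩ V(G)| ≥ ℓ + |B| + 1.
-- Replacing X ∩ V(G) by B ∪ S, where S is the given solution of (G, T_G), is therefore no larger,
-- and it is feasible: a path avoiding the new solution cannot cross the boundary B, so it lives
-- either in G − S or in H − X.
module Submission where

open import Defs
open import Data.Nat using (ℕ; suc; _+_; _≤_; _≡ᵇ_; s≤s⁻¹)
open import Data.Nat.Properties using (_≟_; ≤-refl; ≤-trans; ≤-antisym; +-comm; +-suc; +-monoˡ-≤; +-monoʳ-≤; module ≤-Reasoning)
open import Data.Bool using (true; false; _∨_)
open import Data.Bool.Properties using (∨-identityʳ; ∧-identityʳ; ∨-zeroʳ)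
open import Data.Unit using (⊤; tt)
open import Data.Empty using (⊥-elim)
open import Data.List using (List; []; _∷_; _++_; length; filter; lookup)
open import Data.List.Properties using (length-++; length-filter; filter-notAll)
open import Data.List.Membership.Propositional using (_∈_; _∉_; find)
open import Data.List.Membership.Propositional.Properties using (∈-++⁺ˡ; ∈-++⁺ʳ; ∈-++⁻; ∈-filter⁺; ∈-filter⁻)
open import Data.List.Membership.DecPropositional _≟_ using (_∈?_)
open import Data.List.Relation.Unary.Any as Any using (Any; here; there; index; any?)
open import Data.List.Relation.Unary.Any.Properties using (lookup-index)
open import Data.List.Relation.Unary.All as All using (All; []; _∷_)
open import Data.List.Relation.Unary.All.Properties using (¬Any⇒All¬)
open import Data.List.Relation.Unary.AllPairs using (_∷_)
open import Data.List.Relation.Unary.Unique.Propositional using (Unique)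
import Data.List.Relation.Unary.Unique.Propositional.Properties as Unique
open import Data.Fin using (Fin)
open import Data.Fin.Properties using (injective⇒≤) renaming (_≟_ to _≟ᶠ_)
open import Data.Product using (_×_; Σ; _,_; proj₁; proj₂; uncurry; map)
open import Data.Sum using (_⊎_; inj₁; inj₂; [_,_])
open import Function.Base using (_∘_; _$_)
open import Function.Bundles using (_⇔_; mk⇔; Equivalence)
open import Function.Definitions using (Injective)
open import Relation.Nullary using (¬_; yes; no; contradiction)
open import Relation.Nullary.Decidable using (dec-true; dec-false)
open import Relation.Unary using (Decidable)
open import Relation.Unary.Properties using (∁?)
open import Relation.Binary.PropositionalEquality using (_≡_; _≢_; refl; sym; trans; cong; subst)

∉⇒≢ : ∀ {x y} {xs : List ℕ} → x ∈ xs → y ∉ xs → y ≢ x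
∉⇒≢ x∈ y∉ refl = y∉ x∈

∉-++ : ∀ {x} {xs ys : List ℕ} → x ∉ xs → x ∉ ys → x ∉ xs ++ ys
∉-++ {xs = xs} x∉xs x∉ys = [ x∉xs , x∉ys ] ∘ ∈-++⁻ xs

∈-insert⁺ : ∀ (xs ys : List ℕ) {zs x} → x ∈ xs ++ zs → x ∈ (xs ++ ys) ++ zs
∈-insert⁺ xs ys m = [ ∈-++⁺ˡ ∘ ∈-++⁺ˡ , ∈-++⁺ʳ (xs ++ ys) ] (∈-++⁻ xs m)

∈-insert⁻ : ∀ (xs ys : List ℕ) {zs x} → x ∈ (xs ++ ys) ++ zs → x ∉ ys → x ∈ xs ++ zs
∈-insert⁻ xs ys m x∉ys with ∈-++⁻ (xs ++ ys) m
... | inj₂ x∈zs = ∈-++⁺ʳ xs x∈zs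
... | inj₁ x∈xs++ys = [ ∈-++⁺ˡ , ⊥-elim ∘ x∉ys ] (∈-++⁻ xs x∈xs++ys)

length-filter-∁ : ∀ {P : ℕ → Set} (P? : Decidable P) (xs : List ℕ) →
  length (filter P? xs) + length (filter (∁? P?) xs) ≡ length xs
length-filter-∁ P? [] = refl
length-filter-∁ P? (x ∷ xs) with P? x
... | yes _ = cong suc (length-filter-∁ P? xs)
... | no _ = trans (+-suc _ _) (cong suc (length-filter-∁ P? xs))

distinct-members⇒≤length : ∀ {n} (L : List ℕ) (f : Fin n → ℕ) → (∀ i → f i ∈ L) →
  (∀ i j → i ≢ j → f i ≢ f j) → n ≤ length L
distinct-members⇒≤length L f f∈L distinct = injective⇒≤ index-injective
  where
  index-injective : Injective _≡_ _≡_ (λ i → index (f∈L i))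
  index-injective {i} {j} eq with i ≟ᶠ j
  ... | yes i≡j = i≡j
  ... | no i≢j = contradiction
    (trans (lookup-index (f∈L i)) (trans (cong (lookup L) eq) (sym (lookup-index (f∈L j)))))
    (distinct i j i≢j)

≢⇒≡ᵇ-false : ∀ {x y} → x ≢ y → (x ≡ᵇ y) ≡ false
≢⇒≡ᵇ-false {x} {y} = dec-false (x ≟ y)

≡ᵇ-refl : ∀ x → (x ≡ᵇ x) ≡ true
≡ᵇ-refl x = dec-true (x ≟ x) refl

module _ {G : Graph} (sG : SimpleGraph G) where
  open SimpleGraph sG

  adj-∉ˡ : ∀ {x y} → x ∉ V G → adj G x y ≡ false
  adj-∉ˡ {x} {y} x∉ with adj G x y in e
  ... | true = ⊥-elim (x∉ (proj₁ (inV x y e)))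
  ... | false = refl

⊕-simple : ∀ {G H} → SimpleGraph G → SimpleGraph H → SimpleGraph (G ⊕ H)
⊕-simple {G} {H} sG sH = record { symm = symm⊕ ; irrefl = irrefl⊕ ; inV = inV⊕ }
  where
  open SimpleGraph
  symm⊕ : ∀ x y → adj (G ⊕ H) x y ≡ adj (G ⊕ H) y x
  symm⊕ x y rewrite symm sG x y | symm sH x y = refl
  irrefl⊕ : ∀ x → adj (G ⊕ H) x x ≡ false
  irrefl⊕ x rewrite irrefl sG x | irrefl sH x = refl
  inV⊕ : ∀ x y → adj (G ⊕ H) x y ≡ true → x ∈ V (G ⊕ H) × y ∈ V (G ⊕ H)
  inV⊕ x y e with adj G x y in eG
  ... | true = map ∈-++⁺ˡ ∈-++⁺ˡ (inV sG x y eG)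
  ... | false = map (∈-++⁺ʳ (V G)) (∈-++⁺ʳ (V G)) (inV sH x y e)

module _ {G : Graph} {Y : List ℕ} where

  source∈V : ∀ {s t} → Connected G Y s t → s ∈ V G
  source∈V (here s∈ _) = s∈
  source∈V (step s∈ _ _ _) = s∈

  source∉ : ∀ {s t} → Connected G Y s t → s ∉ Y
  source∉ (here _ s∉) = s∉
  source∉ (step _ s∉ _ _) = s∉

  target∈V : ∀ {s t} → Connected G Y s t → t ∈ V G
  target∈V (here t∈ _) = t∈
  target∈V (step _ _ _ c) = target∈V c

  target∉ : ∀ {s t} → Connected G Y s t → t ∉ Y
  target∉ (here _ t∉) = t∉
  target∉ (step _ _ _ c) = target∉ c

  connected-trans : ∀ {s u t} → Connected G Y s u → Connected G Y u t → Connected G Y s t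
  connected-trans (here _ _) d = d
  connected-trans (step s∈ s∉ e c) d = step s∈ s∉ e (connected-trans c d)

  connected-sym : SimpleGraph G → ∀ {s t} → Connected G Y s t → Connected G Y t s
  connected-sym sG (here s∈ s∉) = here s∈ s∉
  connected-sym sG {s} (step {u = u} s∈ s∉ e c) =
    connected-trans (connected-sym sG c)
      (step (source∈V c) (source∉ c) (trans (SimpleGraph.symm sG u s) e) (here s∈ s∉))

connected-map : ∀ {G₁ G₂ Y₁ Y₂} (Q : ℕ → Set) →
  (∀ {s} → Q s → s ∈ V G₁ → s ∉ Y₁ → s ∈ V G₂ × s ∉ Y₂) →
  (∀ {s u} → Q s → s ∉ Y₁ → u ∉ Y₁ → adj G₁ s u ≡ true → adj G₂ s u ≡ true × Q u) →
  ∀ {s t} → Q s → Connected G₁ Y₁ s t → Connected G₂ Y₂ s t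
connected-map Q vertex edge q (here s∈ s∉) = uncurry here (vertex q s∈ s∉)
connected-map Q vertex edge q (step s∈ s∉ e c) with vertex q s∈ s∉ | edge q s∉ (source∉ c) e
... | s∈′ , s∉′ | e′ , q′ = step s∈′ s∉′ e′ (connected-map Q vertex edge q′ c)

connected-⊕ˡ : ∀ {G H Y s t} → Connected G Y s t → Connected (G ⊕ H) Y s t
connected-⊕ˡ {G} {H} {Y} = connected-map (λ _ → ⊤) (λ _ s∈ s∉ → ∈-++⁺ˡ s∈ , s∉) edge tt
  where
  edge : ∀ {s u} → ⊤ → s ∉ Y → u ∉ Y → adj G s u ≡ true → adj (G ⊕ H) s u ≡ true × ⊤
  edge _ _ _ e rewrite e = refl , tt

walk⊆V : ∀ {G P a b x} → Walk G P a b → x ∈ P → x ∈ V G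
walk⊆V (single x∈) (here refl) = x∈
walk⊆V (cons x∈ _ _) (here refl) = x∈
walk⊆V (cons _ _ w) (there m) = walk⊆V w m

walk⇒connected : ∀ {G P a b Y} → Walk G P a b → All (_∉ Y) P → Connected G Y a b
walk⇒connected (single a∈) (a∉ ∷ []) = here a∈ a∉
walk⇒connected (cons a∈ e w) (a∉ ∷ avoids) = step a∈ a∉ e (walk⇒connected w avoids)

ShrinksInto : Graph → List ℕ → Graph → List ℕ → Set
ShrinksInto G₁ T₁ G₂ T₂ =
  ∀ X → Feasible G₁ T₁ X → Σ (List ℕ) λ Y → Feasible G₂ T₂ Y × length Y ≤ length X

isOPT-transfer : ∀ {G₁ T₁ G₂ T₂ k} → ShrinksInto G₁ T₁ G₂ T₂ → ShrinksInto G₂ T₂ G₁ T₁ →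
  IsOPT G₁ T₁ k → IsOPT G₂ T₂ k
isOPT-transfer {G₂ = G₂} {T₂ = T₂} to from ((X , X-feasible , refl) , minimal) with to X X-feasible
... | Y , Y-feasible , Y≤X = (Y , Y-feasible , ≤-antisym Y≤X (lower-bound Y Y-feasible)) , lower-bound
  where
  lower-bound : ∀ Z → Feasible G₂ T₂ Z → length X ≤ length Z
  lower-bound Z Z-feasible with from Z Z-feasible
  ... | W , W-feasible , W≤Z = ≤-trans (minimal W W-feasible) W≤Z

isOPT-⇔ : ∀ {G₁ T₁ G₂ T₂} → ShrinksInto G₁ T₁ G₂ T₂ → ShrinksInto G₂ T₂ G₁ T₁ →
  ∀ k → IsOPT G₁ T₁ k ⇔ IsOPT G₂ T₂ k
isOPT-⇔ to from k = mk⇔ (isOPT-transfer to from) (isOPT-transfer from to)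

-- A fan against a multiway cut

fan-cut-bound : ∀ {G H T T′ X v n} → SimpleGraph G → SimpleGraph H →
  FanFrom G T v n → Feasible (G ⊕ H) (T ++ T′) X → v ∉ X →
  n ≤ suc (length (filter (_∈? V G) X))
fan-cut-bound {G} {H} {T} {T′} {X} {v} {n} sG sH (P , e , paths , e∈T , e-distinct , meet-at-v)
  (_ , _ , separates) v∉X = distinct-members⇒≤length (v ∷ filter (_∈? V G) X) mark mark-∈ mark-distinct
  where
  Avoids : Fin n → Set
  Avoids i = ¬ Any (_∈ X) (P i)

  avoid-connects : ∀ i → Avoids i → Connected (G ⊕ H) X v (e i)
  avoid-connects i avoids = connected-⊕ˡ (walk⇒connected (proj₁ (paths i)) (¬Any⇒All¬ (P i) avoids))

  at-most-one-avoids : ∀ i j → i ≢ j → Avoids i → ¬ Avoids j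
  at-most-one-avoids i j i≢j avoids-i avoids-j =
    separates (e i) (e j) (∈-++⁺ˡ (e∈T i)) (∈-++⁺ˡ (e∈T j)) (target∉ cᵢ) (target∉ cⱼ) (e-distinct i j i≢j)
      (connected-trans (connected-sym (⊕-simple sG sH) cᵢ) cⱼ)
    where
    cᵢ = avoid-connects i avoids-i
    cⱼ = avoid-connects j avoids-j

  marking : ∀ i → Σ ℕ λ x → (x ∈ P i × x ∈ X) ⊎ (x ≡ v × Avoids i)
  marking i with any? (_∈? X) (P i)
  ... | yes hits = let x , x∈P , x∈X = find hits in x , inj₁ (x∈P , x∈X)
  ... | no avoids = v , inj₂ (refl , avoids)

  mark : Fin n → ℕ
  mark i = proj₁ (marking i)

  mark-∈ : ∀ i → mark i ∈ v ∷ filter (_∈? V G) X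
  mark-∈ i with marking i
  ... | _ , inj₁ (x∈P , x∈X) = there (∈-filter⁺ (_∈? V G) x∈X (walk⊆V (proj₁ (paths i)) x∈P))
  ... | _ , inj₂ (refl , _) = here refl

  mark-distinct : ∀ i j → i ≢ j → mark i ≢ mark j
  mark-distinct i j i≢j with marking i | marking j
  ... | x , inj₁ (x∈Pᵢ , x∈X) | _ , inj₁ (x∈Pⱼ , _) =
    λ { refl → v∉X (subst (_∈ X) (meet-at-v i j i≢j x x∈Pᵢ x∈Pⱼ) x∈X) }
  ... | _ , inj₁ (_ , x∈X) | _ , inj₂ (refl , _) = λ { refl → v∉X x∈X }
  ... | _ , inj₂ (refl , _) | _ , inj₁ (_ , y∈X) = λ { refl → v∉X y∈X }
  ... | _ , inj₂ (refl , avoids-i) | _ , inj₂ (refl , avoids-j) =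
    λ _ → at-most-one-avoids i j i≢j avoids-i avoids-j

-- Replacing the part of a solution inside G

boundaryReplacement : Graph → List ℕ → List ℕ → List ℕ → List ℕ
boundaryReplacement G B S X = filter (∁? (_∈? V G)) X ++ B ++ filter (∁? (_∈? B)) S

module BoundaryReplacement {G H : Graph} {B TG TH : List ℕ}
  (sG : SimpleGraph G) (sH : SimpleGraph H) (uB : Unique B) (B⊆G : B ⊆ V G)
  (shared⇒B : ∀ {x} → x ∈ V H → x ∈ V G → x ∈ B) (TH⊆H : TH ⊆ V H) where

  module _ (S X : List ℕ) where
    private
      Xₕ S∖B X′ : List ℕ
      Xₕ = filter (∁? (_∈? V G)) X
      S∖B = filter (∁? (_∈? B)) S
      X′ = boundaryReplacement G B S X

    B⊆replacement : B ⊆ X′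
    B⊆replacement = ∈-++⁺ʳ Xₕ ∘ ∈-++⁺ˡ

    S⊆replacement : S ⊆ X′
    S⊆replacement {x} x∈S with x ∈? B
    ... | yes x∈B = B⊆replacement x∈B
    ... | no x∉B = ∈-++⁺ʳ Xₕ (∈-++⁺ʳ B (∈-filter⁺ (∁? (_∈? B)) x∈S x∉B))

    ∉replacement⇒∉ : ∀ {x} → x ∉ X′ → x ∉ V G → x ∉ X
    ∉replacement⇒∉ x∉X′ x∉G x∈X = x∉X′ (∈-++⁺ˡ (∈-filter⁺ (∁? (_∈? V G)) x∈X x∉G))

    length-replacement : length S + length B ≤ length (filter (_∈? V G) X) →
      length X′ ≤ length X
    length-replacement S+B≤ = begin
      length X′                                ≡⟨ trans (length-++ Xₕ) (cong (length Xₕ +_) (length-++ B)) ⟩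
      length Xₕ + (length B + length S∖B)      ≤⟨ +-monoʳ-≤ (length Xₕ) (+-monoʳ-≤ (length B) (length-filter (∁? (_∈? B)) S)) ⟩
      length Xₕ + (length B + length S)        ≤⟨ +-monoʳ-≤ (length Xₕ) (subst (_≤ length (filter (_∈? V G) X)) (+-comm (length S) (length B)) S+B≤) ⟩
      length Xₕ + length (filter (_∈? V G) X)  ≡⟨ trans (+-comm (length Xₕ) _) (length-filter-∁ (_∈? V G) X) ⟩
      length X                                 ∎
      where open ≤-Reasoning

    replacement-feasible : Feasible G TG S → Feasible (G ⊕ H) (TG ++ TH) X →
      Feasible (G ⊕ H) (TG ++ TH) X′
    replacement-feasible (uS , S⊆G , S-separates) (uX , X⊆GH , X-separates) =
      unique , X′⊆GH , separates
      where
      ∉X′⇒∉B : ∀ {x} → x ∉ X′ → x ∉ B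
      ∉X′⇒∉B x∉X′ = x∉X′ ∘ B⊆replacement

      B++S∖B⊆G : (B ++ S∖B) ⊆ V G
      B++S∖B⊆G x∈ = [ B⊆G , S⊆G ∘ proj₁ ∘ ∈-filter⁻ (∁? (_∈? B)) ] (∈-++⁻ B x∈)

      unique : Unique X′
      unique = Unique.++⁺ (Unique.filter⁺ (∁? (_∈? V G)) uX)
        (Unique.++⁺ uB (Unique.filter⁺ (∁? (_∈? B)) uS) (λ { (x∈B , x∈S∖B) → proj₂ (∈-filter⁻ (∁? (_∈? B)) {xs = S} x∈S∖B) x∈B }))
        (λ { (x∈Xₕ , x∈rest) → proj₂ (∈-filter⁻ (∁? (_∈? V G)) {xs = X} x∈Xₕ) (B++S∖B⊆G x∈rest) })

      X′⊆GH : X′ ⊆ V (G ⊕ H)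
      X′⊆GH x∈ = [ X⊆GH ∘ proj₁ ∘ ∈-filter⁻ (∁? (_∈? V G)) , ∈-++⁺ˡ ∘ B++S∖B⊆G ] (∈-++⁻ Xₕ x∈)

      inside : ∀ {s t} → s ∈ V G → Connected (G ⊕ H) X′ s t → Connected G S s t
      inside = connected-map (_∈ V G) (λ s∈G _ s∉X′ → s∈G , s∉X′ ∘ S⊆replacement) edge
        where
        edge : ∀ {s u} → s ∈ V G → s ∉ X′ → u ∉ X′ → adj (G ⊕ H) s u ≡ true → adj G s u ≡ true × u ∈ V G
        edge {s} {u} s∈G s∉X′ _ e with adj G s u in eG
        ... | true = refl , proj₂ (SimpleGraph.inV sG s u eG)
        ... | false = ⊥-elim (∉X′⇒∉B s∉X′ (shared⇒B (proj₁ (SimpleGraph.inV sH s u e)) s∈G))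

      outside : ∀ {s t} → s ∉ V G → Connected (G ⊕ H) X′ s t → Connected (G ⊕ H) X s t
      outside = connected-map (_∉ V G) (λ s∉G s∈ s∉X′ → s∈ , ∉replacement⇒∉ s∉X′ s∉G) edge
        where
        edge : ∀ {s u} → s ∉ V G → s ∉ X′ → u ∉ X′ → adj (G ⊕ H) s u ≡ true → adj (G ⊕ H) s u ≡ true × u ∉ V G
        edge {s} {u} s∉G _ u∉X′ e = e , ∉X′⇒∉B u∉X′ ∘ shared⇒B (proj₂ (SimpleGraph.inV sH s u e-in-H))
          where
          e-in-H : adj H s u ≡ true
          e-in-H = trans (cong (_∨ adj H s u) (sym (adj-∉ˡ sG s∉G))) e

      terminal-in-G : ∀ {x} → x ∈ TG ++ TH → x ∈ V G → x ∉ X′ → x ∈ TG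
      terminal-in-G x∈T x∈G x∉X′ =
        [ (λ x∈TG → x∈TG) , (λ x∈TH → contradiction (shared⇒B (TH⊆H x∈TH) x∈G) (∉X′⇒∉B x∉X′)) ] (∈-++⁻ TG x∈T)

      separates : ∀ s t → s ∈ TG ++ TH → t ∈ TG ++ TH → s ∉ X′ → t ∉ X′ → s ≢ t → ¬ Connected (G ⊕ H) X′ s t
      separates s t s∈T t∈T s∉X′ t∉X′ s≢t c with s ∈? V G
      ... | yes s∈G = S-separates s t (terminal-in-G s∈T s∈G s∉X′) (terminal-in-G t∈T (target∈V c′) t∉X′)
                        (s∉X′ ∘ S⊆replacement) (t∉X′ ∘ S⊆replacement) s≢t c′
        where c′ = inside s∈G c
      ... | no s∉G = X-separates s t s∈T t∈T (source∉ c′) (target∉ c′) s≢t c′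
        where c′ = outside s∉G c

-- Splitting a vertex into two pendant terminals

module _ {G : Graph} {v t₁ t₂ : ℕ} where

  splitAt-adj-away : ∀ {x y} → x ≢ v → y ≢ v → adj (splitAt G v t₁ t₂) x y ≡ adj G x y
  splitAt-adj-away {x} {y} x≢v y≢v rewrite ≢⇒≡ᵇ-false x≢v | ≢⇒≡ᵇ-false y≢v =
    trans (∨-identityʳ _) (∧-identityʳ _)

  splitAt-adj-t₁v : t₁ ≢ v → adj (splitAt G v t₁ t₂) t₁ v ≡ true
  splitAt-adj-t₁v t₁≢v rewrite ≡ᵇ-refl v | ≡ᵇ-refl t₁ | ≢⇒≡ᵇ-false t₁≢v = ∨-zeroʳ _

  splitAt-adj-vt₂ : t₁ ≢ t₂ → adj (splitAt G v t₁ t₂) v t₂ ≡ true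
  splitAt-adj-vt₂ t₁≢t₂ rewrite ≡ᵇ-refl v | ≡ᵇ-refl t₂ | ≢⇒≡ᵇ-false (t₁≢t₂ ∘ sym) = ∨-zeroʳ _

module Splitting {G H : Graph} {v t₁ t₂ : ℕ} {TG TH : List ℕ}
  (sG : SimpleGraph G) (sH : SimpleGraph H) (v∈G : v ∈ V G)
  (t₁∉G : t₁ ∉ V G) (t₂∉G : t₂ ∉ V G) (t₁∉H : t₁ ∉ V H) (t₂∉H : t₂ ∉ V H) (t₁≢t₂ : t₁ ≢ t₂) where

  private
    GH G′H : Graph
    GH = G ⊕ H
    G′H = splitAt G v t₁ t₂ ⊕ H
    T T′ pendants gadget : List ℕ
    T = TG ++ TH
    T′ = (TG ++ t₁ ∷ t₂ ∷ []) ++ TH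
    pendants = t₁ ∷ t₂ ∷ []
    gadget = v ∷ pendants
    sGH : SimpleGraph GH
    sGH = ⊕-simple sG sH

  pendant∉GH : ∀ {t} → t ∈ pendants → t ∉ V GH
  pendant∉GH (here refl) = ∉-++ t₁∉G t₁∉H
  pendant∉GH (there (here refl)) = ∉-++ t₂∉G t₂∉H

  ∈GH⇒∉pendants : ∀ {x} → x ∈ V GH → x ∉ pendants
  ∈GH⇒∉pendants x∈ t∈ = pendant∉GH t∈ x∈

  adj-away : ∀ {x y} → x ≢ v → y ≢ v → adj G′H x y ≡ adj GH x y
  adj-away {x} {y} x≢v y≢v = cong (_∨ adj H x y) (splitAt-adj-away {G} {v} {t₁} {t₂} x≢v y≢v)

  pendant-neighbour : ∀ {t u} → t ∈ pendants → adj G′H t u ≡ true → u ≡ v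
  pendant-neighbour {t} {u} t∈ e with u ≟ v
  ... | yes u≡v = u≡v
  ... | no u≢v = contradiction
    (trans (sym e) (trans (adj-away (∉⇒≢ v∈G (pendant∉GH t∈ ∘ ∈-++⁺ˡ)) u≢v) (adj-∉ˡ sGH (pendant∉GH t∈))))
    λ ()

  pendant-isolated : ∀ {Y t u} → t ∈ pendants → v ∈ Y → Connected G′H Y t u → u ≡ t
  pendant-isolated t∈ v∈Y (here _ _) = refl
  pendant-isolated t∈ v∈Y (step _ _ e c) with pendant-neighbour t∈ e
  ... | refl = ⊥-elim (source∉ c v∈Y)

  edge-away : ∀ {Y s u} → v ∈ Y → s ∉ Y → u ∉ Y → adj G′H s u ≡ adj GH s u
  edge-away v∈Y s∉Y u∉Y = adj-away (∉⇒≢ v∈Y s∉Y) (∉⇒≢ v∈Y u∉Y)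

  split-feasible : ∀ {X} → v ∈ X → Feasible GH T X → Feasible G′H T′ X
  split-feasible {X} v∈X (uX , X⊆GH , separates) = uX , ∈-insert⁺ (V G) pendants ∘ X⊆GH , separates′
    where
    unsplit : ∀ {s t} → s ∉ pendants → Connected G′H X s t → Connected GH X s t
    unsplit = connected-map (_∉ pendants) (λ s∉ s∈ s∉X → ∈-insert⁻ (V G) pendants s∈ s∉ , s∉X) edge
      where
      edge : ∀ {s u} → s ∉ pendants → s ∉ X → u ∉ X → adj G′H s u ≡ true → adj GH s u ≡ true × u ∉ pendants
      edge {s} {u} _ s∉X u∉X e = e′ , ∈GH⇒∉pendants (proj₂ (SimpleGraph.inV sGH s u e′))
        where e′ = trans (sym (edge-away v∈X s∉X u∉X)) e

    separates′ : ∀ s t → s ∈ T′ → t ∈ T′ → s ∉ X → t ∉ X → s ≢ t → ¬ Connected G′H X s t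
    separates′ s t s∈T′ t∈T′ s∉X t∉X s≢t c with s ∈? pendants
    ... | yes s∈ = s≢t (sym (pendant-isolated s∈ v∈X c))
    ... | no s∉ = separates s t (∈-insert⁻ TG pendants s∈T′ s∉) (∈-insert⁻ TG pendants t∈T′ (∈GH⇒∉pendants (target∈V c′))) s∉X t∉X s≢t c′
      where c′ = unsplit s∉ c

  meets-gadget : ∀ {Y} → Feasible G′H T′ Y → Any (_∈ gadget) Y
  meets-gadget {Y} (_ , _ , separates) with any? (_∈? gadget) Y
  ... | yes meets = meets
  ... | no misses = ⊥-elim $ separates t₁ t₂ (pendant∈T′ (here refl)) (pendant∈T′ (there (here refl)))
      (avoid (there (here refl))) (avoid (there (there (here refl)))) t₁≢t₂
      (step (pendant∈G′H (here refl)) (avoid (there (here refl))) t₁v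
        (step (∈-++⁺ˡ (∈-++⁺ˡ v∈G)) (avoid (here refl)) vt₂
          (here (pendant∈G′H (there (here refl))) (avoid (there (there (here refl)))))))
    where
    avoid : ∀ {x} → x ∈ gadget → x ∉ Y
    avoid x∈ x∈Y = misses (Any.map (λ { refl → x∈ }) x∈Y)
    pendant∈T′ : ∀ {t} → t ∈ pendants → t ∈ T′
    pendant∈T′ = ∈-++⁺ˡ ∘ ∈-++⁺ʳ TG
    pendant∈G′H : ∀ {t} → t ∈ pendants → t ∈ V G′H
    pendant∈G′H = ∈-++⁺ˡ ∘ ∈-++⁺ʳ (V G)
    t₁v : adj G′H t₁ v ≡ true
    t₁v = cong (_∨ adj H t₁ v) (splitAt-adj-t₁v {G} {v} {t₁} {t₂} (∉⇒≢ v∈G t₁∉G))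
    vt₂ : adj G′H v t₂ ≡ true
    vt₂ = cong (_∨ adj H v t₂) (splitAt-adj-vt₂ {G} {v} {t₁} {t₂} t₁≢t₂)

  normalise : List ℕ → List ℕ
  normalise Y = v ∷ filter (∁? (_∈? gadget)) Y

  normalise-feasible : ∀ {Y} → Feasible G′H T′ Y → Feasible GH T (normalise Y)
  normalise-feasible {Y} (uY , Y⊆G′H , separates) = unique , Y′⊆GH , separates′
    where
    Y′ : List ℕ
    Y′ = normalise Y

    kept : ∀ {x} → x ∈ filter (∁? (_∈? gadget)) Y → x ∈ Y × x ∉ gadget
    kept = ∈-filter⁻ (∁? (_∈? gadget)) {xs = Y}

    unique : Unique Y′
    unique = All.tabulate (λ x∈ v≡x → proj₂ (kept x∈) (here (sym v≡x))) ∷ Unique.filter⁺ (∁? (_∈? gadget)) uY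

    Y′⊆GH : Y′ ⊆ V GH
    Y′⊆GH (here refl) = ∈-++⁺ˡ v∈G
    Y′⊆GH (there x∈) = ∈-insert⁻ (V G) pendants (Y⊆G′H (proj₁ (kept x∈))) (proj₂ (kept x∈) ∘ there)

    ∉Y′⇒∉Y : ∀ {x} → x ∈ V GH → x ∉ Y′ → x ∉ Y
    ∉Y′⇒∉Y {x} x∈GH x∉Y′ x∈Y with x ∈? gadget
    ... | yes (here refl) = x∉Y′ (here refl)
    ... | yes (there x∈pendants) = ∈GH⇒∉pendants x∈GH x∈pendants
    ... | no x∉gadget = x∉Y′ (there (∈-filter⁺ (∁? (_∈? gadget)) x∈Y x∉gadget))

    split : ∀ {s t} → Connected GH Y′ s t → Connected G′H Y s t
    split = connected-map (λ _ → ⊤) (λ _ s∈ s∉Y′ → ∈-insert⁺ (V G) pendants s∈ , ∉Y′⇒∉Y s∈ s∉Y′) edge tt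
      where
      edge : ∀ {s u} → ⊤ → s ∉ Y′ → u ∉ Y′ → adj GH s u ≡ true → adj G′H s u ≡ true × ⊤
      edge _ s∉Y′ u∉Y′ e = trans (edge-away (here refl) s∉Y′ u∉Y′) e , tt

    separates′ : ∀ s t → s ∈ T → t ∈ T → s ∉ Y′ → t ∉ Y′ → s ≢ t → ¬ Connected GH Y′ s t
    separates′ s t s∈T t∈T _ _ s≢t c =
      separates s t (∈-insert⁺ TG pendants s∈T) (∈-insert⁺ TG pendants t∈T) (source∉ c′) (target∉ c′) s≢t c′
      where c′ = split c

  normalise-shorter : ∀ {Y} → Feasible G′H T′ Y → length (normalise Y) ≤ length Y
  normalise-shorter {Y} Y-feasible =
    filter-notAll (∁? (_∈? gadget)) Y (Any.map (λ x∈gadget x∉gadget → x∉gadget x∈gadget) (meets-gadget Y-feasible))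

lemma17 : (G : Graph) (B TG : List ℕ) (ℓ : ℕ) (v t1 t2 : ℕ) →
    SimpleGraph G → Unique B → B ⊆ V G → TG ⊆ V G →
    (Σ (List ℕ) λ S → Feasible G TG S × length S ≤ ℓ) →
    v ∈ B →
    FanFrom G TG v (ℓ + length B + 2) →
    t1 ∉ V G → t2 ∉ V G → t1 ≢ t2 →
    (H : Graph) (TH : List ℕ) →
    SimpleGraph H → TH ⊆ V H →
    (∀ x → (x ∈ V H × x ∈ V G) ⇔ x ∈ B) →
    t1 ∉ V H → t2 ∉ V H →
    (k : ℕ) →
    IsOPT (G ⊕ H) (TG ++ TH) k ⇔ IsOPT (splitAt G v t1 t2 ⊕ H) ((TG ++ t1 ∷ t2 ∷ []) ++ TH) k
lemma17 G B TG ℓ v t1 t2 sG uB B⊆G _ (S , S-feasible , |S|≤ℓ) v∈B fan t1∉G t2∉G t1≢t2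
  H TH sH TH⊆H shared t1∉H t2∉H = isOPT-⇔ delete-v normalise-solution
  where
  open BoundaryReplacement sG sH uB B⊆G (λ x∈H x∈G → Equivalence.to (shared _) (x∈H , x∈G)) TH⊆H
  open Splitting {TG = TG} {TH = TH} sG sH (B⊆G v∈B) t1∉G t2∉G t1∉H t2∉H t1≢t2

  S+B≤ : ∀ {m} → ℓ + length B + 2 ≤ suc m → length S + length B ≤ m
  S+B≤ {m} fan-bound = begin
    length S + length B  ≤⟨ +-monoˡ-≤ (length B) |S|≤ℓ ⟩
    ℓ + length B         <⟨ s≤s⁻¹ (subst (_≤ suc m) (+-comm (ℓ + length B) 2) fan-bound) ⟩
    m                    ∎
    where open ≤-Reasoning

  delete-v : ShrinksInto (G ⊕ H) (TG ++ TH) (splitAt G v t1 t2 ⊕ H) ((TG ++ t1 ∷ t2 ∷ []) ++ TH)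
  delete-v X X-feasible with v ∈? X
  ... | yes v∈X = X , split-feasible v∈X X-feasible , ≤-refl
  ... | no v∉X = boundaryReplacement G B S X ,
      split-feasible (B⊆replacement S X v∈B) (replacement-feasible S X S-feasible X-feasible) ,
      length-replacement S X (S+B≤ (fan-cut-bound sG sH fan X-feasible v∉X))

  normalise-solution : ShrinksInto (splitAt G v t1 t2 ⊕ H) ((TG ++ t1 ∷ t2 ∷ []) ++ TH) (G ⊕ H) (TG ++ TH)
  normalise-solution Y Y-feasible = normalise Y , normalise-feasible Y-feasible , normalise-shorter Y-feasible
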